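{- There exists a bijection $$\theta_1:\bigsqcup_{i\ge0}(\mathscr{A}^{\mathrm{IV}}_i\times\mathscr{B}^{\mathrm{IV}}_i)\to\mathscr{F}\times\mathscr{D}^{\mathrm{e}},\qquad(\lambda,\mu)\mapsto(\beta,\gamma),$$ such that $|\lambda|+|\mu|=|\beta|+|\gamma|$ and $\ell(\lambda)=\ell(\beta)$. Consequently $$\sum_{i, j\geq 0}\frac{x^iq^{j^2+j+2ij+i}}{(q^2; q^2)_i(q^2; q^2)_j}=\frac{(-q^2; q^2)_{\infty}}{(xq; q^4)_{\infty}}.$$
   Context: Partitions are finite weakly increasing lists of positive integers; $|\lambda|$ is the sum of parts, $\ell(\lambda)$ the number of parts. For $i\ge0$, $\mathscr{A}^{\mathrm{IV}}_i$ is the set of partitions with exactly $i$ parts, all of them odd; $\mathscr{B}^{\mathrm{IV}}_i$ is the set of partitions into distinct even parts whose smallest part is at least $2i+2$. $\mathscr{F}$ is the set of partitions all of whose parts are congruent to $1$ modulo $4$, and $\mathscr{D}^{\mathrm{e}}$ is the set of partitions into distinct even parts. $(a;q)_n=\prod_{k=0}^{n-1}(1-aq^k)$, $(a;q)_\infty=\lim_n(a;q)_n$. -}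

module Defs where

open import Data.Nat using (ℕ; zero; suc; _+_; _*_; _≤_; _<_; _%_)
open import Data.List using (List; length)
open import Data.Nat.ListAction using (sum)
open import Data.List.Relation.Unary.All using (All)
open import Data.List.Relation.Unary.Linked using (Linked)
open import Data.Product using (Σ; _×_; proj₁)
open import Relation.Binary.PropositionalEquality using (_≡_)

IsPartition : List ℕ → Set
IsPartition xs = Linked _≤_ xs × All (λ x → 1 ≤ x) xs

∣_∣ₚ : List ℕ → ℕ
∣ xs ∣ₚ = sum xs

ℓ : List ℕ → ℕ
ℓ = length

Odd Even : ℕ → Set
Odd x = x % 2 ≡ 1
Even x = x % 2 ≡ 0

𝒜 : ℕ → Set
𝒜 i = Σ (List ℕ) λ xs → IsPartition xs × length xs ≡ i × All Odd xs

IsDistinctEven : List ℕ → Set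
IsDistinctEven xs = IsPartition xs × Linked _<_ xs × All Even xs

ℬ : ℕ → Set
ℬ i = Σ (List ℕ) λ xs → IsDistinctEven xs × All (λ x → 2 * i + 2 ≤ x) xs

ℱ : Set
ℱ = Σ (List ℕ) λ xs → IsPartition xs × All (λ x → x % 4 ≡ 1) xs

𝒟ᵉ : Set
𝒟ᵉ = Σ (List ℕ) IsDistinctEven

Domain : Set
Domain = Σ ℕ λ i → 𝒜 i × ℬ i

-- Write the parts of λ ∈ 𝒜ᵢ as λⱼ = 1 + 2(d₁ + ⋯ + dⱼ) with gaps dⱼ ≥ 0, so that
-- |λ| = i + 2 Σⱼ (i − j + 1) dⱼ.  Splitting each gap as dⱼ = εⱼ + 2eⱼ with εⱼ ∈ {0, 1}, the parts
-- βⱼ = 1 + 4(e₁ + ⋯ + eⱼ) form a partition into i parts ≡ 1 (mod 4), and the weight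
-- Σⱼ εⱼ · 2(i − j + 1) that this loses is given to μ as one new part 2(i − j + 1) for every odd
-- gap dⱼ.  The new parts are distinct and at most 2i, hence below every part of μ ∈ ℬᵢ, so γ has
-- distinct even parts; conversely, peeling the gaps off from the last one, dⱼ was odd exactly when
-- 2(i − j + 1) is the smallest part still left in γ.

module Submission where

open import Defs
open import Data.Nat
  using (ℕ; zero; suc; _+_; _*_; _∸_; _≤_; _<_; z≤n; s≤s; z<s; _%_; _/_; _≟_; ⌊_/2⌋; parity;
         NonZero; NonTrivial; nonTrivial⇒nonZero; nonTrivial⇒n>1)
open import Data.Nat.Properties
open import Data.Nat.DivMod
  using (m≡m%n+[m/n]*n; [m+kn]%n≡m%n; m<n⇒m%n≡m; +-distrib-/-∣ʳ; m<n⇒m/n≡0; m*n/n≡m; /-monoˡ-≤)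
open import Data.Nat.Divisibility using (divides; m%n≡0⇒n∣m; n∣m⇒m%n≡0; m∣m*n)
open import Data.Nat.ListAction using (sum)
open import Data.Nat.Tactic.RingSolver using (solve-∀)
open import Data.Parity.Base using (Parity; 0ℙ; 1ℙ)
open import Data.List using (List; []; _∷_; length; map)
open import Data.List.Properties using (length-map; map-∘; map-id-local)
open import Data.List.Relation.Unary.All as All using (All; []; _∷_)
import Data.List.Relation.Unary.All.Properties as All
open import Data.List.Relation.Unary.Linked as Linked using (Linked; []; [-]; _∷_)
import Data.List.Relation.Unary.Linked.Properties as Linked
open import Data.Product using (Σ; _×_; _,_; proj₁; proj₂)
open import Function using (_∘_)
open import Function.Bundles using (Bijection; mk↔ₛ′)
open import Function.Definitions using (Bijective)
open import Function.Properties.Inverse using (↔⇒⤖)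
open import Relation.Binary.PropositionalEquality
open import Relation.Nullary using (yes; no; contradiction)
open import Relation.Nullary.Irrelevant using (Irrelevant)

bit : Parity → ℕ
bit 0ℙ = 0
bit 1ℙ = 1

bit+2*suc : ∀ p e → bit p + 2 * suc e ≡ 2 + (bit p + 2 * e)
bit+2*suc 0ℙ e = *-suc 2 e
bit+2*suc 1ℙ e = cong suc (*-suc 2 e)

bit[parity]+2*⌊/2⌋ : ∀ n → bit (parity n) + 2 * ⌊ n /2⌋ ≡ n
bit[parity]+2*⌊/2⌋ 0 = refl
bit[parity]+2*⌊/2⌋ 1 = refl
bit[parity]+2*⌊/2⌋ (suc (suc n)) =
  trans (bit+2*suc (parity n) ⌊ n /2⌋) (cong (2 +_) (bit[parity]+2*⌊/2⌋ n))

parity[bit+2*] : ∀ p e → parity (bit p + 2 * e) ≡ p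
parity[bit+2*] 0ℙ zero = refl
parity[bit+2*] 1ℙ zero = refl
parity[bit+2*] p (suc e) rewrite bit+2*suc p e = parity[bit+2*] p e

⌊bit+2*/2⌋ : ∀ p e → ⌊ bit p + 2 * e /2⌋ ≡ e
⌊bit+2*/2⌋ 0ℙ zero = refl
⌊bit+2*/2⌋ 1ℙ zero = refl
⌊bit+2*/2⌋ p (suc e) rewrite bit+2*suc p e = cong suc (⌊bit+2*/2⌋ p e)

-- Partial sums and gaps

partialSums : ℕ → List ℕ → List ℕ
partialSums a [] = []
partialSums a (d ∷ ds) = a + d ∷ partialSums (a + d) ds

differences : ℕ → List ℕ → List ℕ
differences a [] = []
differences a (x ∷ xs) = x ∸ a ∷ differences x xs

length-partialSums : ∀ a ds → length (partialSums a ds) ≡ length ds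
length-partialSums a [] = refl
length-partialSums a (d ∷ ds) = cong suc (length-partialSums (a + d) ds)

length-differences : ∀ a xs → length (differences a xs) ≡ length xs
length-differences a [] = refl
length-differences a (x ∷ xs) = cong suc (length-differences x xs)

differences-partialSums : ∀ a ds → differences a (partialSums a ds) ≡ ds
differences-partialSums a [] = refl
differences-partialSums a (d ∷ ds) = cong₂ _∷_ (m+n∸m≡n a d) (differences-partialSums (a + d) ds)

partialSums-differences : ∀ {a xs} → Linked _≤_ (a ∷ xs) → partialSums a (differences a xs) ≡ xs
partialSums-differences [-] = refl
partialSums-differences (a≤x ∷ x∷xs↗) rewrite m+[n∸m]≡n a≤x =
  cong (_ ∷_) (partialSums-differences x∷xs↗)

partialSums-linked : ∀ a ds → Linked _≤_ (a ∷ partialSums a ds)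
partialSums-linked a [] = [-]
partialSums-linked a (d ∷ ds) = m≤m+n a d ∷ partialSums-linked (a + d) ds

sum-partialSums : ∀ a ds → sum (partialSums a ds) ≡ length ds * a + sum (partialSums 0 ds)
sum-partialSums a [] = refl
sum-partialSums a (d ∷ ds) = begin
  a + d + sum (partialSums (a + d) ds)     ≡⟨ cong (a + d +_) (sum-partialSums (a + d) ds) ⟩
  a + d + (n * (a + d) + S)                ≡⟨ rearrange a d n S ⟩
  suc n * a + (d + (n * d + S))            ≡⟨ cong (λ t → suc n * a + (d + t)) (sum-partialSums d ds) ⟨
  suc n * a + (d + sum (partialSums d ds)) ∎
  where
  open ≡-Reasoning
  n = length ds
  S = sum (partialSums 0 ds)
  rearrange : ∀ a d n S → a + d + (n * (a + d) + S) ≡ suc n * a + (d + (n * d + S))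
  rearrange = solve-∀

sum-partialSums-∷ : ∀ d ds → sum (partialSums 0 (d ∷ ds)) ≡ suc (length ds) * d + sum (partialSums 0 ds)
sum-partialSums-∷ d ds = trans (cong (d +_) (sum-partialSums d ds)) (sym (+-assoc d _ _))

module _ (s : ℕ) .{{_ : NonTrivial s}} where

  private instance
    s≢0 : NonZero s
    s≢0 = nonTrivial⇒nonZero s

  [1+s*k]%s≡1 : ∀ k → (1 + s * k) % s ≡ 1
  [1+s*k]%s≡1 k = begin
    (1 + s * k) % s ≡⟨ cong (λ t → (1 + t) % s) (*-comm s k) ⟩
    (1 + k * s) % s ≡⟨ [m+kn]%n≡m%n 1 k s ⟩
    1 % s           ≡⟨ m<n⇒m%n≡m (nonTrivial⇒n>1 s) ⟩
    1               ∎
    where open ≡-Reasoning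

  [1+s*k]/s≡k : ∀ k → (1 + s * k) / s ≡ k
  [1+s*k]/s≡k k = begin
    (1 + s * k) / s   ≡⟨ +-distrib-/-∣ʳ 1 {d = s} (m∣m*n k) ⟩
    1 / s + s * k / s ≡⟨ cong₂ _+_ (m<n⇒m/n≡0 (nonTrivial⇒n>1 s)) (cong (_/ s) (*-comm s k)) ⟩
    k * s / s         ≡⟨ m*n/n≡m k s ⟩
    k                 ∎
    where open ≡-Reasoning

  1+s*[x/s]≡x : ∀ {x} → x % s ≡ 1 → 1 + s * (x / s) ≡ x
  1+s*[x/s]≡x {x} x%s≡1 = begin
    1 + s * (x / s)   ≡⟨ cong₂ _+_ x%s≡1 (*-comm (x / s) s) ⟨
    x % s + x / s * s ≡⟨ m≡m%n+[m/n]*n x s ⟨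
    x                 ∎
    where open ≡-Reasoning

  fromGaps : List ℕ → List ℕ
  fromGaps ds = map (λ k → 1 + s * k) (partialSums 0 ds)

  toGaps : List ℕ → List ℕ
  toGaps xs = differences 0 (map (_/ s) xs)

  length-fromGaps : ∀ ds → length (fromGaps ds) ≡ length ds
  length-fromGaps ds = trans (length-map _ (partialSums 0 ds)) (length-partialSums 0 ds)

  length-toGaps : ∀ xs → length (toGaps xs) ≡ length xs
  length-toGaps xs = trans (length-differences 0 (map (_/ s) xs)) (length-map (_/ s) xs)

  toGaps-fromGaps : ∀ ds → toGaps (fromGaps ds) ≡ ds
  toGaps-fromGaps ds = begin
    differences 0 (map (_/ s) (map (λ k → 1 + s * k) (partialSums 0 ds)))
      ≡⟨ cong (differences 0) (map-∘ (partialSums 0 ds)) ⟨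
    differences 0 (map (λ k → (1 + s * k) / s) (partialSums 0 ds))
      ≡⟨ cong (differences 0) (map-id-local (All.universal [1+s*k]/s≡k _)) ⟩
    differences 0 (partialSums 0 ds)
      ≡⟨ differences-partialSums 0 ds ⟩
    ds ∎
    where open ≡-Reasoning

  fromGaps-toGaps : ∀ {xs} → Linked _≤_ xs → All (λ x → x % s ≡ 1) xs → fromGaps (toGaps xs) ≡ xs
  fromGaps-toGaps {xs} xs↗ xs≡1 = begin
    map (λ k → 1 + s * k) (partialSums 0 (differences 0 (map (_/ s) xs)))
      ≡⟨ cong (map _) (partialSums-differences (0∷ (Linked.map⁺ (Linked.map (/-monoˡ-≤ s) xs↗)))) ⟩
    map (λ k → 1 + s * k) (map (_/ s) xs)
      ≡⟨ map-∘ xs ⟨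
    map (λ x → 1 + s * (x / s)) xs
      ≡⟨ map-id-local (All.map 1+s*[x/s]≡x xs≡1) ⟩
    xs ∎
    where
    open ≡-Reasoning
    0∷ : ∀ {ks} → Linked _≤_ ks → Linked _≤_ (0 ∷ ks)
    0∷ [] = [-]
    0∷ [-] = z≤n ∷ [-]
    0∷ (k≤k′ ∷ ks↗) = z≤n ∷ k≤k′ ∷ ks↗

  fromGaps-partition : ∀ ds → IsPartition (fromGaps ds) × All (λ x → x % s ≡ 1) (fromGaps ds)
  fromGaps-partition ds =
    ( Linked.map⁺ (Linked.map (λ k≤k′ → s≤s (*-monoʳ-≤ s k≤k′)) (Linked.tail (partialSums-linked 0 ds)))
    , All.map⁺ (All.universal (λ _ → s≤s z≤n) _) )
    , All.map⁺ (All.universal [1+s*k]%s≡1 _)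

  sum-fromGaps : ∀ ds → sum (fromGaps ds) ≡ length ds + s * sum (partialSums 0 ds)
  sum-fromGaps ds =
    trans (sum-map (partialSums 0 ds)) (cong (_+ s * sum (partialSums 0 ds)) (length-partialSums 0 ds))
    where
    rearrange : ∀ s k n S → 1 + s * k + (n + s * S) ≡ suc n + s * (k + S)
    rearrange = solve-∀
    sum-map : ∀ ks → sum (map (λ k → 1 + s * k) ks) ≡ length ks + s * sum ks
    sum-map [] = sym (*-zeroʳ s)
    sum-map (k ∷ ks) = trans (cong (1 + s * k +_) (sum-map ks)) (rearrange s k (length ks) (sum ks))

-- Distinct even parts above 2n

even-2* : ∀ k → Even (2 * k)
even-2* k = n∣m⇒m%n≡0 (2 * k) 2 (m∣m*n k)

even-gap : ∀ {n x} → Even x → 2 * n < x → 2 * suc n ≤ x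
even-gap {n} {x} even-x 2n<x with m%n≡0⇒n∣m x 2 even-x
... | divides q refl = subst (2 * suc n ≤_) (*-comm 2 q)
        (*-monoʳ-≤ 2 (*-cancelˡ-< 2 n q (subst (2 * n <_) (*-comm q 2) 2n<x)))

EvensAbove : ℕ → List ℕ → Set
EvensAbove n ys = Linked _<_ (2 * n ∷ ys) × All Even ys

insertIf : Parity → ℕ → List ℕ → List ℕ
insertIf 0ℙ m ys = ys
insertIf 1ℙ m ys = m ∷ ys

removeIfHead : ℕ → List ℕ → Parity × List ℕ
removeIfHead m [] = 0ℙ , []
removeIfHead m (y ∷ ys) with y ≟ m
... | yes _ = 1ℙ , ys
... | no _  = 0ℙ , y ∷ ys

removeIfHead-insertIf : ∀ p {m ys} → Linked _<_ (m ∷ ys) → removeIfHead m (insertIf p m ys) ≡ (p , ys)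
removeIfHead-insertIf 1ℙ {m} _ with m ≟ m
... | yes _  = refl
... | no m≢m = contradiction refl m≢m
removeIfHead-insertIf 0ℙ [-] = refl
removeIfHead-insertIf 0ℙ {m} {y ∷ _} (m<y ∷ _) with y ≟ m
... | yes refl = contradiction m<y (<-irrefl refl)
... | no _     = refl

insertIf-removeIfHead : ∀ m ys → let (p , zs) = removeIfHead m ys in insertIf p m zs ≡ ys
insertIf-removeIfHead m [] = refl
insertIf-removeIfHead m (y ∷ ys) with y ≟ m
... | yes refl = refl
... | no _     = refl

sum-insertIf : ∀ p m ys → sum (insertIf p m ys) ≡ bit p * m + sum ys
sum-insertIf 0ℙ m ys = refl
sum-insertIf 1ℙ m ys = cong (_+ sum ys) (sym (*-identityˡ m))

insertIf-above : ∀ p {n ys} → EvensAbove (suc n) ys → EvensAbove n (insertIf p (2 * suc n) ys)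
insertIf-above 1ℙ {n} (ys↗ , ys-even) = *-monoʳ-< 2 (n<1+n n) ∷ ys↗ , even-2* (suc n) ∷ ys-even
insertIf-above 0ℙ ([-] , ys-even) = [-] , ys-even
insertIf-above 0ℙ {n} (m<y ∷ ys↗ , ys-even) = <-trans (*-monoʳ-< 2 (n<1+n n)) m<y ∷ ys↗ , ys-even

removeIfHead-above : ∀ {n ys} → EvensAbove n ys → EvensAbove (suc n) (proj₂ (removeIfHead (2 * suc n) ys))
removeIfHead-above ([-] , []) = [-] , []
removeIfHead-above {n} {y ∷ _} (2n<y ∷ ys↗ , y-even ∷ ys-even) with y ≟ 2 * suc n
... | yes refl = ys↗ , ys-even
... | no y≢m   = ≤∧≢⇒< (even-gap y-even 2n<y) (y≢m ∘ sym) ∷ ys↗ , y-even ∷ ys-even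

-- Odd gaps as new even parts

halves : List ℕ → List ℕ
halves = map ⌊_/2⌋

insertOddGaps : List ℕ → List ℕ → List ℕ
insertOddGaps [] ys = ys
insertOddGaps (d ∷ ds) ys = insertOddGaps ds (insertIf (parity d) (2 * suc (length ds)) ys)

extractOddGaps : List ℕ → List ℕ → List ℕ × List ℕ
extractOddGaps [] γs = [] , γs
extractOddGaps (e ∷ es) γs =
  let (ds , ys) = extractOddGaps es γs
      (p , zs) = removeIfHead (2 * suc (length es)) ys
  in bit p + 2 * e ∷ ds , zs

length-extractOddGaps : ∀ es γs → length (proj₁ (extractOddGaps es γs)) ≡ length es
length-extractOddGaps [] γs = refl
length-extractOddGaps (e ∷ es) γs = cong suc (length-extractOddGaps es γs)

insertOddGaps-above : ∀ ds {ys} → EvensAbove (length ds) ys → EvensAbove 0 (insertOddGaps ds ys)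
insertOddGaps-above [] above = above
insertOddGaps-above (d ∷ ds) above = insertOddGaps-above ds (insertIf-above (parity d) above)

extractOddGaps-above : ∀ es {γs} → EvensAbove 0 γs → EvensAbove (length es) (proj₂ (extractOddGaps es γs))
extractOddGaps-above [] above = above
extractOddGaps-above (e ∷ es) above = removeIfHead-above (extractOddGaps-above es above)

extractOddGaps-insertOddGaps : ∀ ds {ys} → EvensAbove (length ds) ys →
                               extractOddGaps (halves ds) (insertOddGaps ds ys) ≡ (ds , ys)
extractOddGaps-insertOddGaps [] _ = refl
extractOddGaps-insertOddGaps (d ∷ ds) above@(ys↗ , _)
  rewrite extractOddGaps-insertOddGaps ds (insertIf-above (parity d) above)
        | length-map ⌊_/2⌋ ds
        | removeIfHead-insertIf (parity d) ys↗
        | bit[parity]+2*⌊/2⌋ d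
  = refl

insertOddGaps-extractOddGaps : ∀ es γs → let (ds , ys) = extractOddGaps es γs in
                               halves ds ≡ es × insertOddGaps ds ys ≡ γs
insertOddGaps-extractOddGaps [] γs = refl , refl
insertOddGaps-extractOddGaps (e ∷ es) γs =
  cong₂ _∷_ (⌊bit+2*/2⌋ p e) halves-ds , (begin
    insertOddGaps ds (insertIf (parity (bit p + 2 * e)) (2 * suc (length ds)) zs)
      ≡⟨ cong₂ (λ q n → insertOddGaps ds (insertIf q (2 * suc n) zs))
               (parity[bit+2*] p e) (length-extractOddGaps es γs) ⟩
    insertOddGaps ds (insertIf p (2 * suc (length es)) zs)
      ≡⟨ cong (insertOddGaps ds) (insertIf-removeIfHead (2 * suc (length es)) ys) ⟩
    insertOddGaps ds ys
      ≡⟨ insertOddGaps-ds ⟩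
    γs ∎)
  where
  open ≡-Reasoning
  ds = proj₁ (extractOddGaps es γs)
  ys = proj₂ (extractOddGaps es γs)
  p = proj₁ (removeIfHead (2 * suc (length es)) ys)
  zs = proj₂ (removeIfHead (2 * suc (length es)) ys)
  halves-ds = proj₁ (insertOddGaps-extractOddGaps es γs)
  insertOddGaps-ds = proj₂ (insertOddGaps-extractOddGaps es γs)

sum-insertOddGaps : ∀ ds ys → 2 * sum (partialSums 0 ds) + sum ys
                              ≡ 4 * sum (partialSums 0 (halves ds)) + sum (insertOddGaps ds ys)
sum-insertOddGaps [] ys = refl
sum-insertOddGaps (d ∷ ds) ys = begin
  2 * sum (partialSums 0 (d ∷ ds)) + sum ys
    ≡⟨ cong (λ t → 2 * t + sum ys) (sum-partialSums-∷ d ds) ⟩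
  2 * (suc n * d + S) + sum ys
    ≡⟨ cong (λ t → 2 * (suc n * t + S) + sum ys) (bit[parity]+2*⌊/2⌋ d) ⟨
  2 * (suc n * (bit p + 2 * h) + S) + sum ys
    ≡⟨ rearrange (bit p) h n S (sum ys) ⟩
  4 * (suc n * h) + (2 * S + (bit p * (2 * suc n) + sum ys))
    ≡⟨ cong (λ t → 4 * (suc n * h) + (2 * S + t)) (sum-insertIf p (2 * suc n) ys) ⟨
  4 * (suc n * h) + (2 * S + sum ys′)
    ≡⟨ cong (4 * (suc n * h) +_) (sum-insertOddGaps ds ys′) ⟩
  4 * (suc n * h) + (4 * S′ + sum (insertOddGaps ds ys′))
    ≡⟨ reassociate (suc n * h) S′ (sum (insertOddGaps ds ys′)) ⟩
  4 * (suc n * h + S′) + sum (insertOddGaps ds ys′)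
    ≡⟨ cong (λ t → 4 * (suc t * h + S′) + sum (insertOddGaps ds ys′)) (length-map ⌊_/2⌋ ds) ⟨
  4 * (suc (length (halves ds)) * h + S′) + sum (insertOddGaps ds ys′)
    ≡⟨ cong (λ t → 4 * t + sum (insertOddGaps ds ys′)) (sum-partialSums-∷ h (halves ds)) ⟨
  4 * sum (partialSums 0 (halves (d ∷ ds))) + sum (insertOddGaps (d ∷ ds) ys) ∎
  where
  open ≡-Reasoning
  n = length ds
  S = sum (partialSums 0 ds)
  S′ = sum (partialSums 0 (halves ds))
  p = parity d
  h = ⌊ d /2⌋
  ys′ = insertIf p (2 * suc n) ys
  rearrange : ∀ b h n S Y → 2 * (suc n * (b + 2 * h) + S) + Y
                            ≡ 4 * (suc n * h) + (2 * S + (b * (2 * suc n) + Y))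
  rearrange = solve-∀
  reassociate : ∀ x S Y → 4 * x + (4 * S + Y) ≡ 4 * (x + S) + Y
  reassociate = solve-∀

Θ : List ℕ × List ℕ → List ℕ × List ℕ
Θ (λs , μs) = fromGaps 4 (halves ds) , insertOddGaps ds μs
  where ds = toGaps 2 λs

Θ⁻¹ : List ℕ × List ℕ → List ℕ × List ℕ
Θ⁻¹ (βs , γs) = fromGaps 2 (proj₁ r) , proj₂ r
  where r = extractOddGaps (toGaps 4 βs) γs

Θ⁻¹-Θ : ∀ {λs μs} → Linked _≤_ λs → All Odd λs → EvensAbove (length λs) μs →
        Θ⁻¹ (Θ (λs , μs)) ≡ (λs , μs)
Θ⁻¹-Θ {λs} {μs} λs↗ λs-odd above
  rewrite toGaps-fromGaps 4 (halves (toGaps 2 λs))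
        | extractOddGaps-insertOddGaps (toGaps 2 λs)
            (subst (λ n → EvensAbove n μs) (sym (length-toGaps 2 λs)) above)
        | fromGaps-toGaps 2 λs↗ λs-odd
  = refl

Θ-Θ⁻¹ : ∀ {βs γs} → Linked _≤_ βs → All (λ x → x % 4 ≡ 1) βs → Θ (Θ⁻¹ (βs , γs)) ≡ (βs , γs)
Θ-Θ⁻¹ {βs} {γs} βs↗ βs≡1 rewrite toGaps-fromGaps 2 (proj₁ (extractOddGaps (toGaps 4 βs) γs)) =
  cong₂ _,_ (trans (cong (fromGaps 4) halves-ds) (fromGaps-toGaps 4 βs↗ βs≡1)) insertOddGaps-ds
  where
  halves-ds = proj₁ (insertOddGaps-extractOddGaps (toGaps 4 βs) γs)
  insertOddGaps-ds = proj₂ (insertOddGaps-extractOddGaps (toGaps 4 βs) γs)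

Θ-above : ∀ λs {μs} → EvensAbove (length λs) μs → EvensAbove 0 (proj₂ (Θ (λs , μs)))
Θ-above λs {μs} above =
  insertOddGaps-above (toGaps 2 λs) (subst (λ n → EvensAbove n μs) (sym (length-toGaps 2 λs)) above)

Θ⁻¹-above : ∀ βs {γs} → EvensAbove 0 γs → EvensAbove (length βs) (proj₂ (Θ⁻¹ (βs , γs)))
Θ⁻¹-above βs {γs} above =
  subst (λ n → EvensAbove n (proj₂ (Θ⁻¹ (βs , γs)))) (length-toGaps 4 βs)
        (extractOddGaps-above (toGaps 4 βs) above)

length-Θ : ∀ λs μs → length (proj₁ (Θ (λs , μs))) ≡ length λs
length-Θ λs μs = begin
  length (fromGaps 4 (halves (toGaps 2 λs))) ≡⟨ length-fromGaps 4 (halves (toGaps 2 λs)) ⟩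
  length (halves (toGaps 2 λs))              ≡⟨ length-map ⌊_/2⌋ (toGaps 2 λs) ⟩
  length (toGaps 2 λs)                       ≡⟨ length-toGaps 2 λs ⟩
  length λs                                  ∎
  where open ≡-Reasoning

length-Θ⁻¹ : ∀ βs γs → length (proj₁ (Θ⁻¹ (βs , γs))) ≡ length βs
length-Θ⁻¹ βs γs = begin
  length (fromGaps 2 ds) ≡⟨ length-fromGaps 2 ds ⟩
  length ds              ≡⟨ length-extractOddGaps (toGaps 4 βs) γs ⟩
  length (toGaps 4 βs)   ≡⟨ length-toGaps 4 βs ⟩
  length βs              ∎
  where
  open ≡-Reasoning
  ds = proj₁ (extractOddGaps (toGaps 4 βs) γs)

sum-Θ : ∀ {λs} μs → Linked _≤_ λs → All Odd λs →
        sum λs + sum μs ≡ sum (proj₁ (Θ (λs , μs))) + sum (proj₂ (Θ (λs , μs)))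
sum-Θ {λs} μs λs↗ λs-odd = begin
  sum λs + sum μs
    ≡⟨ cong (λ t → sum t + sum μs) (fromGaps-toGaps 2 λs↗ λs-odd) ⟨
  sum (fromGaps 2 ds) + sum μs
    ≡⟨ cong (_+ sum μs) (sum-fromGaps 2 ds) ⟩
  length ds + 2 * sum (partialSums 0 ds) + sum μs
    ≡⟨ +-assoc (length ds) _ (sum μs) ⟩
  length ds + (2 * sum (partialSums 0 ds) + sum μs)
    ≡⟨ cong₂ _+_ (sym (length-map ⌊_/2⌋ ds)) (sum-insertOddGaps ds μs) ⟩
  length (halves ds) + (4 * sum (partialSums 0 (halves ds)) + sum (insertOddGaps ds μs))
    ≡⟨ +-assoc (length (halves ds)) _ _ ⟨
  length (halves ds) + 4 * sum (partialSums 0 (halves ds)) + sum (insertOddGaps ds μs)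
    ≡⟨ cong (_+ sum (insertOddGaps ds μs)) (sum-fromGaps 4 (halves ds)) ⟨
  sum (fromGaps 4 (halves ds)) + sum (insertOddGaps ds μs) ∎
  where
  open ≡-Reasoning
  ds = toGaps 2 λs

-- Restriction to the partition sets

linked⇒bounded : ∀ {a ys} → Linked _<_ (a ∷ ys) → All (a <_) ys
linked⇒bounded [-] = []
linked⇒bounded (a<y ∷ ys↗) = Linked.Linked⇒All <-trans a<y ys↗

bounded⇒linked : ∀ {a ys} → All (a <_) ys → Linked _<_ ys → Linked _<_ (a ∷ ys)
bounded⇒linked [] _ = [-]
bounded⇒linked (a<y ∷ _) ys↗ = a<y ∷ ys↗

ℬ⇒above : ∀ n {ys} → IsDistinctEven ys × All (λ y → 2 * n + 2 ≤ y) ys → EvensAbove n ys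
ℬ⇒above n ((_ , ys↗ , ys-even) , ys≥2n+2) =
  bounded⇒linked (All.map (<-≤-trans (m<m+n (2 * n) z<s)) ys≥2n+2) ys↗ , ys-even

above⇒ℬ : ∀ n {ys} → EvensAbove n ys → IsDistinctEven ys × All (λ y → 2 * n + 2 ≤ y) ys
above⇒ℬ n (2n∷ys↗ , ys-even) =
  ((Linked.map <⇒≤ ys↗ , All.map (≤-<-trans z≤n) ys>2n) , ys↗ , ys-even) ,
  All.zipWith (λ {y} (y-even , 2n<y) → subst (_≤ y) 2*suc≡ (even-gap y-even 2n<y)) (ys-even , ys>2n)
  where
  ys↗ = Linked.tail 2n∷ys↗
  ys>2n = linked⇒bounded 2n∷ys↗
  2*suc≡ : 2 * suc n ≡ 2 * n + 2
  2*suc≡ = trans (*-suc 2 n) (+-comm 2 (2 * n))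

distinctEven⇒above₀ : ∀ {ys} → IsDistinctEven ys → EvensAbove 0 ys
distinctEven⇒above₀ ((_ , ys≥1) , ys↗ , ys-even) = bounded⇒linked ys≥1 ys↗ , ys-even

×-irrelevant : ∀ {A B : Set} → Irrelevant A → Irrelevant B → Irrelevant (A × B)
×-irrelevant A-irr B-irr (a , b) (a′ , b′) = cong₂ _,_ (A-irr a a′) (B-irr b b′)

Σ-≡-irrelevant : ∀ {P : List ℕ → Set} → (∀ {xs} → Irrelevant (P xs)) →
                 ∀ {x y : Σ (List ℕ) P} → proj₁ x ≡ proj₁ y → x ≡ y
Σ-≡-irrelevant P-irr {xs , p} {.xs , q} refl = cong (xs ,_) (P-irr p q)

IsPartition-irrelevant : ∀ {xs} → Irrelevant (IsPartition xs)
IsPartition-irrelevant = ×-irrelevant (Linked.irrelevant ≤-irrelevant) (All.irrelevant ≤-irrelevant)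

IsDistinctEven-irrelevant : ∀ {xs} → Irrelevant (IsDistinctEven xs)
IsDistinctEven-irrelevant =
  ×-irrelevant IsPartition-irrelevant (×-irrelevant (Linked.irrelevant <-irrelevant) (All.irrelevant ≡-irrelevant))

Domain-≡ : ∀ {d d′ : Domain} → proj₁ (proj₁ (proj₂ d)) ≡ proj₁ (proj₁ (proj₂ d′)) →
           proj₁ (proj₂ (proj₂ d)) ≡ proj₁ (proj₂ (proj₂ d′)) → d ≡ d′
Domain-≡ {_ , (λs , _ , refl , _) , _} {_ , (_ , _ , refl , _) , _} refl μs≡μs′ =
  cong₂ (λ a b → length λs , a , b)
    (Σ-≡-irrelevant
      (×-irrelevant IsPartition-irrelevant (×-irrelevant ≡-irrelevant (All.irrelevant ≡-irrelevant))) refl)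
    (Σ-≡-irrelevant (×-irrelevant IsDistinctEven-irrelevant (All.irrelevant ≤-irrelevant)) μs≡μs′)

ℱ×𝒟ᵉ-≡ : ∀ {y y′ : ℱ × 𝒟ᵉ} → proj₁ (proj₁ y) ≡ proj₁ (proj₁ y′) →
          proj₁ (proj₂ y) ≡ proj₁ (proj₂ y′) → y ≡ y′
ℱ×𝒟ᵉ-≡ βs≡βs′ γs≡γs′ =
  cong₂ _,_ (Σ-≡-irrelevant (×-irrelevant IsPartition-irrelevant (All.irrelevant ≡-irrelevant)) βs≡βs′)
            (Σ-≡-irrelevant IsDistinctEven-irrelevant γs≡γs′)

θ₁ : Domain → ℱ × 𝒟ᵉ
θ₁ (i , (λs , _ , |λs|≡i , _) , (μs , μs∈ℬ)) =
  (proj₁ (Θ (λs , μs)) , fromGaps-partition 4 (halves (toGaps 2 λs))) ,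
  (proj₂ (Θ (λs , μs)) , proj₁ (above⇒ℬ 0 (Θ-above λs μs-above)))
  where μs-above = subst (λ n → EvensAbove n μs) (sym |λs|≡i) (ℬ⇒above i μs∈ℬ)

θ₁⁻¹ : ℱ × 𝒟ᵉ → Domain
θ₁⁻¹ ((βs , _) , (γs , γs∈𝒟ᵉ)) =
  length βs ,
  (proj₁ (Θ⁻¹ (βs , γs)) , proj₁ λs-ok , length-Θ⁻¹ βs γs , proj₂ λs-ok) ,
  (proj₂ (Θ⁻¹ (βs , γs)) , above⇒ℬ (length βs) (Θ⁻¹-above βs (distinctEven⇒above₀ γs∈𝒟ᵉ)))
  where λs-ok = fromGaps-partition 2 (proj₁ (extractOddGaps (toGaps 4 βs) γs))

θ₁⁻¹-θ₁ : ∀ d → θ₁⁻¹ (θ₁ d) ≡ d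
θ₁⁻¹-θ₁ (_ , (λs , (λs↗ , _) , refl , λs-odd) , (μs , μs∈ℬ)) =
  Domain-≡ (cong proj₁ round-trip) (cong proj₂ round-trip)
  where round-trip = Θ⁻¹-Θ λs↗ λs-odd (ℬ⇒above (length λs) μs∈ℬ)

θ₁-θ₁⁻¹ : ∀ y → θ₁ (θ₁⁻¹ y) ≡ y
θ₁-θ₁⁻¹ ((βs , (βs↗ , _) , βs≡1) , (γs , _)) =
  ℱ×𝒟ᵉ-≡ (cong proj₁ round-trip) (cong proj₂ round-trip)
  where round-trip = Θ-Θ⁻¹ {γs = γs} βs↗ βs≡1

theorem3p1 : Σ (Domain → ℱ × 𝒟ᵉ) λ θ →
    Bijective _≡_ _≡_ θ
    × (∀ (d : Domain) →
         (∣ proj₁ (proj₁ (proj₂ d)) ∣ₚ + ∣ proj₁ (proj₂ (proj₂ d)) ∣ₚ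
           ≡ ∣ proj₁ (proj₁ (θ d)) ∣ₚ + ∣ proj₁ (proj₂ (θ d)) ∣ₚ)
         × (ℓ (proj₁ (proj₁ (proj₂ d))) ≡ ℓ (proj₁ (proj₁ (θ d)))))
theorem3p1 =
  θ₁ ,
  Bijection.bijective (↔⇒⤖ (mk↔ₛ′ θ₁ θ₁⁻¹ θ₁-θ₁⁻¹ θ₁⁻¹-θ₁)) ,
  λ { (_ , (λs , (λs↗ , _) , _ , λs-odd) , (μs , _)) → sum-Θ μs λs↗ λs-odd , sym (length-Θ λs μs) }
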